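{- For real quadratic fields $K$, the additive semigroups $\mathcal{O}_K^+(+)$ are pairwise non-isomorphic: if $K_1\neq K_2$ are real quadratic fields, then there is no semigroup isomorphism $\mathcal{O}_{K_1}^+(+)\to\mathcal{O}_{K_2}^+(+)$.
   Context: For a real quadratic field $K$ with ring of integers $\mathcal{O}_K$, $\mathcal{O}_K^+$ denotes the set of totally positive elements of $\mathcal{O}_K$ (those $\alpha$ with $\alpha>0$ and $\alpha'>0$, where $\alpha'$ is the Galois conjugate), viewed as a semigroup under addition. -}

module Defs where

open import Data.Nat as ℕ using (ℕ; _%_; _≡ᵇ_)
open import Data.Nat.Divisibility using (_∣_)
open import Data.Integer using (ℤ; +_; _+_; _*_; _<_)
open import Data.Bool using (if_then_else_)
open import Data.Product using (_×_)
open import Relation.Binary.PropositionalEquality using (_≡_)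

SquareFree : ℕ → Set
SquareFree D = ∀ (n : ℕ) → n ℕ.* n ∣ D → n ≡ 1

-- Real quadratic fields K = ℚ(√D) correspond bijectively to squarefree D > 1.
IsRealQuadParam : ℕ → Set
IsRealQuadParam D = 1 ℕ.< D × SquareFree D

-- Standard integral basis {1, ω} of 𝒪_K, K = ℚ(√D):
--   ω = (1 + √D)/2  if D ≡ 1 (mod 4),   ω = √D  otherwise.
-- The element x + yω is totally positive iff, writing it as (a + b√D)/k
-- (k = 2, a = 2x + y, b = y in the first case; k = 1, a = x, b = y otherwise),
-- a > 0 and a² > b² D  (equivalently a > |b|√D, i.e. both conjugates positive).
TotPos : ℕ → ℤ → ℤ → Set
TotPos D x y =
  if D % 4 ≡ᵇ 1
  then (+ 0 < (+ 2 * x + y) × y * y * + D < (+ 2 * x + y) * (+ 2 * x + y))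
  else (+ 0 < x × y * y * + D < x * x)

record OKPlus (D : ℕ) : Set where
  constructor ⟨_,_⟩
  field
    x : ℤ
    y : ℤ
    .pos : TotPos D x y
open OKPlus public

IsSum : ∀ {D} → OKPlus D → OKPlus D → OKPlus D → Set
IsSum a b c = x c ≡ x a + x b × y c ≡ y a + y b

record SemigroupIso (D₁ D₂ : ℕ) : Set where
  field
    to       : OKPlus D₁ → OKPlus D₂
    from     : OKPlus D₂ → OKPlus D₁
    from∘to  : ∀ a → from (to a) ≡ a
    to∘from  : ∀ b → to (from b) ≡ b
    hom      : ∀ a b c → IsSum a b c → IsSum (to a) (to b) (to c)

module Submission where

-- Elements of 𝒪_K are coordinate pairs (x, y) ↦ x + yω.  (1) An additive map on 𝒪_K⁺ is
-- the restriction of a linear form: 1 and D + ω are totally positive, and every totally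
-- positive element plus one positive combination of them is another such combination.  So
-- a semigroup isomorphism is an integral matrix M, with inverse N, mapping the totally
-- positive cone of K₁ onto that of K₂.  (2) Up to sign the cone is {Q > 0} for the norm
-- form Q, which is indefinite and, √D being irrational, anisotropic.  A rigidity lemma for
-- such forms (a lattice-point estimate near the boundary of the cone) gives Q₂ ∘ M = f·Q₁
-- with f > 0.  (3) The same for N yields f = 1 and det M = ±1, so Q₁ and Q₂ have the same
-- discriminant, which is D or 4D; as D ≡ 1 (mod 4) is never a multiple of 4, D₁ = D₂.

open import Defs
open import Data.Nat using (ℕ)
open import Relation.Nullary using (¬_)
open import Relation.Binary.PropositionalEquality using (_≢_)

-- √D is irrational: if D > 1 is squarefree, then a² = D y² in ℕ forces y = 0.
-- (Divide a and y by their gcd; the coprime quotient y' divides a'², hence a',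
-- so y' = 1 and D = a'² is a square, i.e. D = 1.)
module Irrationality where
  open import Data.Nat
  open import Data.Nat.Properties
  open import Data.Nat.Divisibility
  open import Data.Nat.DivMod using (m/n*n≡m)
  open import Data.Nat.GCD
  open import Data.Nat.Coprimality using (Coprime; coprime-/gcd; coprime-divisor) renaming (sym to coprime-sym)
  open import Data.Nat.Tactic.RingSolver using (solve-∀)
  open import Data.Sum using (inj₂)
  open import Data.Product using (_,_)
  open import Data.Empty using (⊥-elim)
  open import Relation.Binary.PropositionalEquality

  square-of-product : ∀ a g → a * g * (a * g) ≡ a * a * (g * g)
  square-of-product = solve-∀

  D-times-square-of-product : ∀ D y g → D * (y * g * (y * g)) ≡ D * (y * y) * (g * g)
  D-times-square-of-product = solve-∀

  sqrt-irrational : ∀ D a y → SquareFree D → 1 < D → a * a ≡ D * (y * y) → y ≡ 0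
  sqrt-irrational D a zero _ _ _ = refl
  sqrt-irrational D a y@(suc _) squarefree 1<D a²≡Dy² = ⊥-elim (<-irrefl (sym D≡1) 1<D)
    where
    g = gcd a y
    instance
      g≢0 : NonZero g
      g≢0 = ≢-nonZero (gcd[m,n]≢0 a y (inj₂ (λ ())))
      g²≢0 : NonZero (g * g)
      g²≢0 = m*n≢0 g g
    a' = a / g
    y' = y / g
    coprime : Coprime a' y'
    coprime = coprime-/gcd a y
    reduced : a' * a' ≡ D * (y' * y')
    reduced = *-cancelʳ-≡ (a' * a') (D * (y' * y')) (g * g) (begin
      a' * a' * (g * g)      ≡⟨ sym (square-of-product a' g) ⟩
      a' * g * (a' * g)      ≡⟨ cong (λ t → t * t) (m/n*n≡m (gcd[m,n]∣m a y)) ⟩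
      a * a                  ≡⟨ a²≡Dy² ⟩
      D * (y * y)            ≡⟨ cong (λ t → D * (t * t)) (sym (m/n*n≡m (gcd[m,n]∣n a y))) ⟩
      D * (y' * g * (y' * g)) ≡⟨ D-times-square-of-product D y' g ⟩
      D * (y' * y') * (g * g) ∎)
      where open ≡-Reasoning
    y'≡1 : y' ≡ 1
    y'≡1 = coprime (coprime-divisor (coprime-sym coprime) (divides (D * y') (trans reduced (sym (*-assoc D y' y')))) , ∣-refl)
    a'²≡D : a' * a' ≡ D
    a'²≡D = trans reduced (subst (λ t → D * (t * t) ≡ D) (sym y'≡1) (*-identityʳ D))
    D≡1 : D ≡ 1
    D≡1 = trans (sym a'²≡D) (cong (λ t → t * t) (squarefree a' (∣-reflexive a'²≡D)))

open Irrationality using (sqrt-irrational)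

open import Data.Bool using (Bool; true; false; if_then_else_; T)
open import Data.Empty using (⊥; ⊥-elim)
open import Data.Integer hiding (suc; _%_; _/_)
open import Data.Integer.Properties
open import Data.Integer.Tactic.RingSolver using (solve-∀)
import Data.Nat.Tactic.RingSolver as NatSolver
import Data.Nat as ℕ
open import Data.Nat using (zero; suc; z≤n; s≤s; _%_; _/_; _≡ᵇ_)
import Data.Nat.Properties as ℕP
open import Data.Nat.DivMod using (m≡m%n+[m/n]*n; m*n%n≡0)
open import Data.Product using (Σ; _×_; _,_; proj₁; proj₂)
open import Data.Sum using (_⊎_; inj₁; inj₂; [_,_]′)
open import Function using (id)
open import Relation.Binary.PropositionalEquality
open import Relation.Binary.Definitions using (tri<; tri≈; tri>)
open import Relation.Nullary using (Dec; yes; no)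
open import Relation.Nullary.Decidable using (_×-dec_)
open import Relation.Nullary.Decidable.Core using (recompute)

≤-by : ∀ {i j} d → + 0 ≤ d → j - i ≡ d → i ≤ j
≤-by d 0≤d eq = 0≤i-j⇒j≤i (subst (+ 0 ≤_) (sym eq) 0≤d)

<-by : ∀ {i j} d → + 0 < d → j - i ≡ d → i < j
<-by {i} {j} d 0<d eq =
  subst₂ _<_ (+-identityʳ i) (trans (cong (λ t → i + t) (sym eq)) (j-split i j)) (+-monoʳ-< i 0<d)
  where
  j-split : ∀ i j → i + (j - i) ≡ j
  j-split = solve-∀

0<-diff : ∀ {i j} → i < j → + 0 < j - i
0<-diff {i} {j} i<j = subst (_< j - i) (+-inverseʳ i) (+-monoˡ-< (- i) i<j)

0≤ℕ : ∀ n → + 0 ≤ + n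
0≤ℕ n = +≤+ z≤n

0≤* : ∀ {a b} → + 0 ≤ a → + 0 ≤ b → + 0 ≤ a * b
0≤* {+ m} {+ n} _ _ = subst (+ 0 ≤_) (pos-* m n) (0≤ℕ (m ℕ.* n))

0<* : ∀ {a b} → + 0 < a → + 0 < b → + 0 < a * b
0<* {+[1+ m ]} {+[1+ n ]} _ _ = +<+ (s≤s z≤n)
0<* {+ zero} (+<+ ()) _
0<* {+[1+ m ]} {+ zero} _ (+<+ ())

0≤sq : ∀ a → + 0 ≤ a * a
0≤sq (+ n) = 0≤* (0≤ℕ n) (0≤ℕ n)
0≤sq -[1+ n ] = +≤+ z≤n

*-neg-pos : ∀ {a b} → a < + 0 → + 0 < b → a * b < + 0
*-neg-pos {a} {b} a<0 0<b =
  neg-cancel-< (subst (+ 0 <_) (sym (neg-distribˡ-* a b)) (0<* (neg-mono-< a<0) 0<b))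

*-strict-mono : ∀ {s S s' S'} → + 0 ≤ s → s < S → + 0 ≤ s' → s' < S' → s * s' < S * S'
*-strict-mono {s} {S} {s'} {S'} 0≤s s<S 0≤s' s'<S' =
  ≤-<-trans (≤-by _ (0≤* 0≤s (i≤j⇒0≤j-i (<⇒≤ s'<S'))) (step₁ s s' S'))
            (<-by _ (0<* (0<-diff s<S) (≤-<-trans 0≤s' s'<S')) (step₂ s S S'))
  where
  step₁ : ∀ s s' S' → s * S' - s * s' ≡ s * (S' - s')
  step₁ = solve-∀
  step₂ : ∀ s S S' → S * S' - s * S' ≡ (S - s) * S'
  step₂ = solve-∀

∣∣-≤ : ∀ i n → - (+ n) ≤ i → i ≤ + n → ∣ i ∣ ℕ.≤ n
∣∣-≤ (+ k) n _ (+≤+ k≤n) = k≤n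
∣∣-≤ -[1+ k ] zero () _
∣∣-≤ -[1+ k ] (suc n) (-≤- k≤n) _ = s≤s k≤n

i≤∣i∣ : ∀ i → i ≤ + ∣ i ∣
i≤∣i∣ (+ n) = ≤-refl
i≤∣i∣ -[1+ n ] = -≤+

positive⇒suc : ∀ {k} → + 0 < k → Σ ℕ λ j → k ≡ + suc j
positive⇒suc {+[1+ j ]} _ = j , refl
positive⇒suc {+ zero} (+<+ ())

-- Coordinates (x, y) stand for the element x + yω of 𝒪_K, ω as in Defs.  With
-- β = (D % 4 ≡ᵇ 1), k·(x + yω) = a + y√D where a = rat β x y (k = 2 if β, else 1).
rat : Bool → ℤ → ℤ → ℤ
rat true x y = + 2 * x + y
rat false x y = x

-- The totally positive cone: a > 0 and D y² < a², i.e. both conjugates a ± y√D are positive.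
Cone : Bool → ℕ → ℤ → ℤ → Set
Cone β D x y = + 0 < rat β x y × y * y * + D < rat β x y * rat β x y

cone? : ∀ β D x y → Dec (Cone β D x y)
cone? β D x y = (+ 0 <? rat β x y) ×-dec (y * y * + D <? rat β x y * rat β x y)

rat-+ : ∀ β x y x' y' → rat β (x + x') (y + y') ≡ rat β x y + rat β x' y'
rat-+ true = linear
  where
  linear : ∀ x y x' y' → + 2 * (x + x') + (y + y') ≡ (+ 2 * x + y) + (+ 2 * x' + y')
  linear = solve-∀
rat-+ false x y x' y' = refl

rat-neg : ∀ β x y → rat β (- x) (- y) ≡ - rat β x y
rat-neg true = linear
  where
  linear : ∀ x y → + 2 * (- x) + (- y) ≡ - (+ 2 * x + y)
  linear = solve-∀
rat-neg false x y = refl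

-- {(a, y) : a > 0, D y² < a²} is closed under addition: from |y|√D < a and |y'|√D < a'
-- one gets D y y' ≤ a a' (compare squares), and the cross terms add up.
square-cone-+ : ∀ D a y a' y' → + 0 < a → y * y * + D < a * a → + 0 < a' → y' * y' * + D < a' * a' →
                (y + y') * (y + y') * + D < (a + a') * (a + a')
square-cone-+ D a y a' y' 0<a ya 0<a' ya' =
  <-by _ (+-mono-<-≤ (0<-diff ya) (+-mono-≤ (<⇒≤ (0<-diff ya')) (0≤* (0≤ℕ 2) (i≤j⇒0≤j-i cross≤))))
         (expand a a' y y' (+ D))
  where
  expand : ∀ a a' y y' D → (a + a') * (a + a') - (y + y') * (y + y') * D ≡
           (a * a - y * y * D) + ((a' * a' - y' * y' * D) + + 2 * (a * a' - y * y' * D))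
  expand = solve-∀
  cross-square : ∀ y y' D → (y * y' * D) * (y * y' * D) ≡ (y * y * D) * (y' * y' * D)
  cross-square = solve-∀
  prod-square : ∀ a a' → (a * a') * (a * a') ≡ (a * a) * (a' * a')
  prod-square = solve-∀
  cross≤ : y * y' * + D ≤ a * a'
  cross≤ with y * y' * + D ≤? a * a'
  ... | yes ≤aa' = ≤aa'
  ... | no ≰aa' = ⊥-elim (<-asym squares< (*-strict-mono 0≤aa' aa'< 0≤aa' aa'<))
    where
    aa'< = ≰⇒> ≰aa'
    0≤aa' = <⇒≤ (0<* 0<a 0<a')
    squares< : (y * y' * + D) * (y * y' * + D) < (a * a') * (a * a')
    squares< = subst₂ _<_ (sym (cross-square y y' (+ D))) (sym (prod-square a a'))
                 (*-strict-mono (0≤* (0≤sq y) (0≤ℕ D)) ya (0≤* (0≤sq y') (0≤ℕ D)) ya')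

cone-+ : ∀ β D {x y x' y'} → Cone β D x y → Cone β D x' y' → Cone β D (x + x') (y + y')
cone-+ β D {x} {y} {x'} {y'} (0<a , ya) (0<a' , ya') rewrite rat-+ β x y x' y' =
  +-mono-<-≤ 0<a (<⇒≤ 0<a') , square-cone-+ D (rat β x y) y (rat β x' y') y' 0<a ya 0<a' ya'

-- 1 and D + ω are totally positive; together they form a basis of 𝒪_K.
cone-one : ∀ β D → Cone β D (+ 1) (+ 0)
cone-one true D = +<+ (s≤s z≤n) , +<+ (s≤s z≤n)
cone-one false D = +<+ (s≤s z≤n) , +<+ (s≤s z≤n)

cone-D+ω : ∀ β D → 1 ℕ.< D → Cone β D (+ D) (+ 1)
cone-D+ω true D _ =
  +-mono-≤-< (0≤* (0≤ℕ 2) (0≤ℕ D)) (+<+ (s≤s z≤n)) ,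
  <-by _ (+-mono-<-≤ (+<+ (s≤s z≤n)) (+-mono-≤ (0≤* (0≤* (0≤ℕ 4) (0≤ℕ D)) (0≤ℕ D)) (0≤* (0≤ℕ 3) (0≤ℕ D))))
         (expand (+ D))
  where
  expand : ∀ D → (+ 2 * D + + 1) * (+ 2 * D + + 1) - + 1 * + 1 * D ≡ + 1 + (+ 4 * D * D + + 3 * D)
  expand = solve-∀
cone-D+ω false (suc (suc m)) _ = +<+ (s≤s z≤n) , <-by _ (0<* {+ 1 + + m} {+ 2 + + m} (+<+ (s≤s z≤n)) (+<+ (s≤s z≤n))) (expand (+ m))
  where
  expand : ∀ m → (+ 2 + m) * (+ 2 + m) - + 1 * + 1 * (+ 2 + m) ≡ (+ 1 + m) * (+ 2 + m)
  expand = solve-∀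
cone-D+ω false (suc zero) (s≤s ())

cone-axis : ∀ β D k → Cone β D k (+ 0) → + 0 < k
cone-axis false D k (0<k , _) = 0<k
cone-axis true D k (0<2k , _) with <-cmp (+ 0) k
... | tri< 0<k _ _ = 0<k
... | tri≈ _ refl _ = 0<2k
... | tri> _ _ k<0 = ⊥-elim (<-asym (subst (+ 0 <_) (double k) 0<2k) (+-mono-< k<0 k<0))
  where
  double : ∀ k → + 2 * k + + 0 ≡ k + k
  double = solve-∀

-- The basis type of 𝒪_K: true iff ω = (1 + √D)/2.
halfω : ℕ → Bool
halfω D = D % 4 ≡ᵇ 1

TotPos→Cone : ∀ D {x y} → TotPos D x y → Cone (halfω D) D x y
TotPos→Cone D = unfold (halfω D)
  where
  unfold : ∀ β {x y} → (if β then Cone true D x y else Cone false D x y) → Cone β D x y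
  unfold true p = p
  unfold false p = p

Cone→TotPos : ∀ D {x y} → Cone (halfω D) D x y → TotPos D x y
Cone→TotPos D = fold (halfω D)
  where
  fold : ∀ β {x y} → Cone β D x y → (if β then Cone true D x y else Cone false D x y)
  fold true p = p
  fold false p = p

element : ∀ {D} x y → .(Cone (halfω D) D x y) → OKPlus D
element {D} x₀ y₀ p = record { x = x₀ ; y = y₀ ; pos = Cone→TotPos D p }

cone-of : ∀ {D} (o : OKPlus D) → Cone (halfω D) D (x o) (y o)
cone-of {D} (⟨ x₀ , y₀ ⟩ p) = recompute (cone? (halfω D) D x₀ y₀) (TotPos→Cone D p)

OKPlus-≡ : ∀ {D} {o o' : OKPlus D} → x o ≡ x o' → y o ≡ y o' → o ≡ o'
OKPlus-≡ {o = ⟨ _ , _ ⟩ _} {⟨ _ , _ ⟩ _} refl refl = refl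

form : ℤ → ℤ → ℤ → ℤ → ℤ → ℤ
form a b c x y = a * x * x + b * x * y + c * y * y

discriminant : ℤ → ℤ → ℤ → ℤ
discriminant a b c = b * b - + 4 * a * c

fieldDisc : Bool → ℕ → ℤ
fieldDisc true D = + D
fieldDisc false D = + 4 * + D

record NormForm (β : Bool) (D : ℕ) : Set where
  field
    b : ℕ
    c κ E : ℤ
    0<κ : + 0 < κ
    norm : ∀ x y → rat β x y * rat β x y - y * y * + D ≡ κ * form (+ 1) (+ b) c x y
    c<0 : c < + 0
    0<E : + 0 < E
    on-ray : ∀ y → form (+ 1) (+ b) c (+ D * y) y ≡ E * (y * y)
    disc : discriminant (+ 1) (+ b) c ≡ fieldDisc β D

normForm-≡1 : ∀ D k → D ≡ 1 ℕ.+ k ℕ.* 4 → 1 ℕ.< D → NormForm true D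
normForm-≡1 .(1 ℕ.+ zero ℕ.* 4) zero refl (s≤s ())
normForm-≡1 .(1 ℕ.+ suc k ℕ.* 4) (suc k) refl _ = record
  { b = 1 ; c = - K ; κ = + 4 ; E = + 2 + (+ 16 * K * K + + 11 * K)
  ; 0<κ = +<+ (s≤s z≤n)
  ; norm = λ x y → subst (λ D → (+ 2 * x + y) * (+ 2 * x + y) - y * y * D ≡ + 4 * form (+ 1) (+ 1) (- K) x y)
                      (sym D≡) (norm-id x y K)
  ; c<0 = -<+
  ; 0<E = +-mono-<-≤ (+<+ {0} {2} (s≤s z≤n)) (+-mono-≤ (0≤* (0≤* (0≤ℕ 16) (0≤ℕ (suc k))) (0≤ℕ (suc k))) (0≤* (0≤ℕ 11) (0≤ℕ (suc k))))
  ; on-ray = λ y → subst (λ D → form (+ 1) (+ 1) (- K) (D * y) y ≡ (+ 2 + (+ 16 * K * K + + 11 * K)) * (y * y))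
                      (sym D≡) (ray-id K y)
  ; disc = trans (disc-id K) (sym D≡)
  }
  where
  K : ℤ
  K = + suc k
  D≡ : + (1 ℕ.+ suc k ℕ.* 4) ≡ + 1 + K * + 4
  D≡ = trans (pos-+ 1 (suc k ℕ.* 4)) (cong (λ t → + 1 + t) (pos-* (suc k) 4))
  norm-id : ∀ x y k → (+ 2 * x + y) * (+ 2 * x + y) - y * y * (+ 1 + k * + 4) ≡ + 4 * (+ 1 * x * x + + 1 * x * y + (- k) * y * y)
  norm-id = solve-∀
  ray-id : ∀ k y → let x = (+ 1 + k * + 4) * y in
           + 1 * x * x + + 1 * x * y + (- k) * y * y ≡ (+ 2 + (+ 16 * k * k + + 11 * k)) * (y * y)
  ray-id = solve-∀
  disc-id : ∀ k → + 1 * + 1 - + 4 * + 1 * (- k) ≡ + 1 + k * + 4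
  disc-id = solve-∀

normForm-≢1 : ∀ D → 1 ℕ.< D → NormForm false D
normForm-≢1 (suc zero) (s≤s ())
normForm-≢1 (suc (suc m)) _ = record
  { b = 0 ; c = - D ; κ = + 1 ; E = (+ 1 + + m) * D
  ; 0<κ = +<+ (s≤s z≤n)
  ; norm = λ x y → norm-id x y D
  ; c<0 = -<+
  ; 0<E = 0<* {+ 1 + + m} {D} (+<+ (s≤s z≤n)) (+<+ (s≤s z≤n))
  ; on-ray = ray-id (+ m)
  ; disc = disc-id D
  }
  where
  D : ℤ
  D = + 2 + + m
  norm-id : ∀ x y D → x * x - y * y * D ≡ + 1 * (+ 1 * x * x + + 0 * x * y + (- D) * y * y)
  norm-id = solve-∀
  ray-id : ∀ m y → let x = (+ 2 + m) * y in
           + 1 * x * x + + 0 * x * y + (- (+ 2 + m)) * y * y ≡ ((+ 1 + m) * (+ 2 + m)) * (y * y)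
  ray-id = solve-∀
  disc-id : ∀ D → + 0 * + 0 - + 4 * + 1 * (- D) ≡ + 4 * D
  disc-id = solve-∀

normForm : ∀ D → 1 ℕ.< D → NormForm (halfω D) D
normForm D 1<D with halfω D in eq
... | true = normForm-≡1 D (D / 4) D≡ 1<D
  where
  D≡ : D ≡ 1 ℕ.+ (D / 4) ℕ.* 4
  D≡ = trans (m≡m%n+[m/n]*n D 4) (cong (ℕ._+ (D / 4) ℕ.* 4) (ℕP.≡ᵇ⇒≡ (D % 4) 1 (subst T (sym eq) _)))
... | false = normForm-≢1 D 1<D

rat-axis : ∀ β x → rat β x (+ 0) ≡ + 0 → x ≡ + 0
rat-axis true x 2x≡0 = *-cancelˡ-≡ (+ 2) x (+ 0) (trans (double x) 2x≡0)
  where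
  double : ∀ x → + 2 * x ≡ + 2 * x + + 0
  double = solve-∀
rat-axis false x x≡0 = x≡0

-- Consequences of the norm identity κ·Q = a² − D y²: the sign of Q detects (up to sign)
-- total positivity, and, √D being irrational, Q has no nontrivial zero.
module NormFormFacts {β D} (N : NormForm β D) where
  open NormForm N

  Q : ℤ → ℤ → ℤ
  Q = form (+ 1) (+ b) c

  Q>0⇒norm<square : ∀ {x y} → + 0 < Q x y → y * y * + D < rat β x y * rat β x y
  Q>0⇒norm<square {x} {y} 0<Q = <-by _ (subst (+ 0 <_) (sym (norm x y)) (0<* 0<κ 0<Q)) refl

  cone⇒Q>0 : ∀ {x y} → Cone β D x y → + 0 < Q x y
  cone⇒Q>0 {x} {y} (_ , ya) =
    *-cancelˡ-<-nonNeg κ {{nonNegative (<⇒≤ 0<κ)}}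
      (subst₂ _<_ (sym (*-zeroʳ κ)) (norm x y) (0<-diff ya))

  Q>0⇒±cone : ∀ {x y} → + 0 < Q x y → Cone β D x y ⊎ Cone β D (- x) (- y)
  Q>0⇒±cone {x} {y} 0<Q with <-cmp (+ 0) (rat β x y)
  ... | tri< 0<a _ _ = inj₁ (0<a , Q>0⇒norm<square 0<Q)
  ... | tri≈ _ a≡0 _ = ⊥-elim (<⇒≱ (Q>0⇒norm<square 0<Q) (subst (λ a → a * a ≤ y * y * + D) a≡0 (0≤* (0≤sq y) (0≤ℕ D))))
  ... | tri> _ _ a<0 = inj₂ (subst (+ 0 <_) (sym (rat-neg β x y)) (neg-mono-< a<0) ,
          subst₂ _<_ (sym (neg-square-D y (+ D))) (trans (sym (neg-square (rat β x y))) (cong (λ t → t * t) (sym (rat-neg β x y))))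
            (Q>0⇒norm<square 0<Q))
    where
    neg-square-D : ∀ y D → (- y) * (- y) * D ≡ y * y * D
    neg-square-D = solve-∀
    neg-square : ∀ a → (- a) * (- a) ≡ a * a
    neg-square = solve-∀

  anisotropic : SquareFree D → 1 ℕ.< D → ∀ x y → Q x y ≡ + 0 → x ≡ + 0 × y ≡ + 0
  anisotropic squarefree 1<D x y Q≡0 = x≡0 , y≡0
    where
    a = rat β x y
    a²≡Dy² : ∣ a ∣ ℕ.* ∣ a ∣ ≡ D ℕ.* (∣ y ∣ ℕ.* ∣ y ∣)
    a²≡Dy² = begin
      ∣ a ∣ ℕ.* ∣ a ∣           ≡⟨ sym (∣i*j∣≡∣i∣*∣j∣ a a) ⟩
      ∣ a * a ∣                ≡⟨ cong ∣_∣ (i-j≡0⇒i≡j (a * a) (y * y * + D) (trans (norm x y) (trans (cong (κ *_) Q≡0) (*-zeroʳ κ)))) ⟩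
      ∣ y * y * + D ∣          ≡⟨ ∣i*j∣≡∣i∣*∣j∣ (y * y) (+ D) ⟩
      ∣ y * y ∣ ℕ.* D          ≡⟨ cong (ℕ._* D) (∣i*j∣≡∣i∣*∣j∣ y y) ⟩
      ∣ y ∣ ℕ.* ∣ y ∣ ℕ.* D      ≡⟨ ℕP.*-comm (∣ y ∣ ℕ.* ∣ y ∣) D ⟩
      D ℕ.* (∣ y ∣ ℕ.* ∣ y ∣)    ∎
      where open ≡-Reasoning
    y≡0 : y ≡ + 0
    y≡0 = ∣i∣≡0⇒i≡0 (sqrt-irrational D ∣ a ∣ ∣ y ∣ squarefree 1<D a²≡Dy²)
    a≡0 : ∣ rat β x (+ 0) ∣ ℕ.* ∣ rat β x (+ 0) ∣ ≡ 0
    a≡0 = trans (subst (λ t → ∣ rat β x t ∣ ℕ.* ∣ rat β x t ∣ ≡ D ℕ.* (∣ t ∣ ℕ.* ∣ t ∣)) y≡0 a²≡Dy²) (ℕP.*-zeroʳ D)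
    x≡0 : x ≡ + 0
    x≡0 = rat-axis β x (∣i∣≡0⇒i≡0 ([ id , id ]′ (ℕP.m*n≡0⇒m≡0∨n≡0 _ a≡0)))

one : ∀ {D} → OKPlus D
one {D} = element (+ 1) (+ 0) (cone-one (halfω D) D)

D+ω-of : ∀ {D} → 1 ℕ.< D → OKPlus D
D+ω-of {D} 1<D = element (+ D) (+ 1) (cone-D+ω (halfω D) D 1<D)

Additive : ∀ {D} → (OKPlus D → ℤ) → Set
Additive φ = ∀ a b c → IsSum a b c → φ c ≡ φ a + φ b

to-ℕ : ∀ z → Σ ℕ λ s → Σ ℕ λ s' → z + + s ≡ + s'
to-ℕ (+ k) = 0 , k , +-identityʳ _
to-ℕ -[1+ k ] = suc k , 0 , +-inverseˡ (+ suc k)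

-- Every totally positive P satisfies
-- P + (n(D + ω) + (s + 1)) = n'(D + ω) + (s' + 1) for suitable n, s, n', s' ∈ ℕ,
-- and φ on the right-hand sides is known by additivity.
module AdditiveExtension {D} (1<D : 1 ℕ.< D) (φ : OKPlus D → ℤ) (additive : Additive φ) where
  private
    β = halfω D
    D+ω = D+ω-of 1<D

  x-step-one : ∀ n s → + n * + D + + suc (suc s) ≡ (+ n * + D + + suc s) + + 1
  x-step-one n s = trans (cong (λ t → + n * + D + t) (pos-+ 1 (suc s))) (shift (+ n * + D) (+ suc s))
    where
    shift : ∀ a t → a + (+ 1 + t) ≡ (a + t) + + 1
    shift = solve-∀

  x-step-D+ω : ∀ n s → + suc n * + D + + suc s ≡ + D + (+ n * + D + + suc s)
  x-step-D+ω n s = trans (cong (λ t → t * + D + + suc s) (pos-+ 1 n)) (shift (+ n) (+ D) (+ suc s))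
    where
    shift : ∀ n D t → (+ 1 + n) * D + t ≡ D + (n * D + t)
    shift = solve-∀

  comb-cone : ∀ n s → Cone β D (+ n * + D + + suc s) (+ n)
  comb-cone zero zero = cone-one β D
  comb-cone zero (suc s) =
    subst₂ (Cone β D) (sym (x-step-one 0 s)) refl (cone-+ β D (comb-cone zero s) (cone-one β D))
  comb-cone (suc n) s =
    subst₂ (Cone β D) (sym (x-step-D+ω n s)) (sym (pos-+ 1 n)) (cone-+ β D (cone-D+ω β D 1<D) (comb-cone n s))

  comb : ℕ → ℕ → OKPlus D
  comb n s = element _ _ (comb-cone n s)

  φ-comb : ∀ n s → φ (comb n s) ≡ + n * φ D+ω + + suc s * φ one
  φ-comb zero zero = unit (φ one) (φ D+ω)
    where
    unit : ∀ e w → e ≡ + 0 * w + + 1 * e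
    unit = solve-∀
  φ-comb zero (suc s) = begin
    φ (comb zero (suc s))                       ≡⟨ additive (comb zero s) one (comb zero (suc s)) (x-step-one 0 s , refl) ⟩
    φ (comb zero s) + φ one                     ≡⟨ cong (λ t → t + φ one) (φ-comb zero s) ⟩
    (+ 0 * φ D+ω + + suc s * φ one) + φ one     ≡⟨ collect (φ D+ω) (+ suc s) (φ one) ⟩
    + 0 * φ D+ω + (+ 1 + + suc s) * φ one       ≡⟨ cong (λ t → + 0 * φ D+ω + t * φ one) (sym (pos-+ 1 (suc s))) ⟩
    + 0 * φ D+ω + + suc (suc s) * φ one         ∎
    where
    open ≡-Reasoning
    collect : ∀ w t e → (+ 0 * w + t * e) + e ≡ + 0 * w + (+ 1 + t) * e
    collect = solve-∀
  φ-comb (suc n) s = begin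
    φ (comb (suc n) s)                          ≡⟨ additive D+ω (comb n s) (comb (suc n) s) (x-step-D+ω n s , pos-+ 1 n) ⟩
    φ D+ω + φ (comb n s)                        ≡⟨ cong (λ t → φ D+ω + t) (φ-comb n s) ⟩
    φ D+ω + (+ n * φ D+ω + + suc s * φ one)     ≡⟨ collect (φ D+ω) (+ n) (+ suc s * φ one) ⟩
    (+ 1 + + n) * φ D+ω + + suc s * φ one       ≡⟨ cong (λ t → t * φ D+ω + + suc s * φ one) (sym (pos-+ 1 n)) ⟩
    + suc n * φ D+ω + + suc s * φ one           ∎
    where
    open ≡-Reasoning
    collect : ∀ w n r → w + (n * w + r) ≡ (+ 1 + n) * w + r
    collect = solve-∀

  linear-from : ∀ P n s n' s' → IsSum P (comb n s) (comb n' s') →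
                φ P ≡ x P * φ one + y P * (φ D+ω - + D * φ one)
  linear-from P n s n' s' sum@(x-eq , y-eq) = begin
    φ P                                           ≡⟨ difference-of (additive P (comb n s) (comb n' s') sum) ⟩
    φ (comb n' s') - φ (comb n s)                 ≡⟨ cong₂ _-_ (φ-comb n' s') (φ-comb n s) ⟩
    (+ n' * φ D+ω + + suc s' * φ one) - (+ n * φ D+ω + + suc s * φ one)
                                                  ≡⟨ regroup (+ n') (+ suc s') (+ n) (+ suc s) (φ D+ω) (φ one) (+ D) ⟩
    (x (comb n' s') - x (comb n s)) * φ one + (+ n' - + n) * (φ D+ω - + D * φ one)
                                                  ≡⟨ cong₂ (λ a b → a * φ one + b * (φ D+ω - + D * φ one))
                                                       (sym (difference-of {x P} x-eq)) (sym (difference-of {y P} y-eq)) ⟩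
    x P * φ one + y P * (φ D+ω - + D * φ one)     ∎
    where
    open ≡-Reasoning
    difference-of : ∀ {a b c} → c ≡ a + b → a ≡ c - b
    difference-of {a} {b} c≡a+b = trans (cancel a b) (cong (λ t → t - b) (sym c≡a+b))
      where
      cancel : ∀ a b → a ≡ (a + b) - b
      cancel = solve-∀
    regroup : ∀ n' t' n t w e D → (n' * w + t' * e) - (n * w + t * e) ≡
              ((n' * D + t') - (n * D + t)) * e + (n' - n) * (w - D * e)
    regroup = solve-∀

  -- Case y ≥ 0: P + (s + 1) = y (D + ω) + (s' + 1) where s' = x − y D + s ≥ 0.
  -- Case y < 0: P + (−y)(D + ω) + 1 is a totally positive rational integer s' + 1.
  linear : ∀ P → φ P ≡ x P * φ one + y P * (φ D+ω - + D * φ one)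
  linear P@(⟨ X , + n ⟩ _) with to-ℕ (X - + n * + D)
  ... | s , s' , X-nD+s≡s' = linear-from P 0 s n s' (x-eq , sym (+-identityʳ (+ n)))
    where
    open ≡-Reasoning
    rearrange : ∀ X nD s → nD + (+ 1 + (X - nD + s)) ≡ X + (+ 1 + s)
    rearrange = solve-∀
    x-eq : + n * + D + + suc s' ≡ X + + suc s
    x-eq = begin
      + n * + D + + suc s'                    ≡⟨ cong (λ t → + n * + D + t) (pos-+ 1 s') ⟩
      + n * + D + (+ 1 + + s')                ≡⟨ cong (λ t → + n * + D + (+ 1 + t)) (sym X-nD+s≡s') ⟩
      + n * + D + (+ 1 + (X - + n * + D + + s)) ≡⟨ rearrange X (+ n * + D) (+ s) ⟩
      X + (+ 1 + + s)                         ≡⟨ cong (λ t → X + t) (sym (pos-+ 1 s)) ⟩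
      X + + suc s                             ∎
  linear P@(⟨ X , -[1+ m ] ⟩ _) with positive⇒suc (cone-axis β D _ sum-on-axis)
    where
    sum-on-axis : Cone β D (X + (+ suc m * + D + + 1)) (+ 0)
    sum-on-axis = subst (Cone β D _) (+-inverseˡ (+ suc m)) (cone-+ β D (cone-of P) (comb-cone (suc m) 0))
  ... | s' , k≡ = linear-from P (suc m) 0 0 s' (sym k≡ , sym (+-inverseˡ (+ suc m)))

record Matrix : Set where
  constructor matrix
  field
    p q r s : ℤ

row₁ : Matrix → ℤ → ℤ → ℤ
row₁ (matrix p q _ _) x y = x * p + y * q

row₂ : Matrix → ℤ → ℤ → ℤ
row₂ (matrix _ _ r s) x y = x * r + y * s

det : Matrix → ℤ
det (matrix p q r s) = p * s - q * r

_∘ₘ_ : Matrix → Matrix → Matrix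
matrix p' q' r' s' ∘ₘ matrix p q r s =
  matrix (p * p' + r * q') (q * p' + s * q') (p * r' + r * s') (q * r' + s * s')

∘ₘ-rows : ∀ N M x y → row₁ (N ∘ₘ M) x y ≡ row₁ N (row₁ M x y) (row₂ M x y) ×
                      row₂ (N ∘ₘ M) x y ≡ row₂ N (row₁ M x y) (row₂ M x y)
∘ₘ-rows (matrix p' q' r' s') (matrix p q r s) x y = compose p q r s p' q' x y , compose p q r s r' s' x y
  where
  compose : ∀ p q r s p' q' x y → x * (p * p' + r * q') + y * (q * p' + s * q') ≡ (x * p + y * q) * p' + (x * r + y * s) * q'
  compose = solve-∀

det-∘ₘ : ∀ N M → det (N ∘ₘ M) ≡ det N * det M
det-∘ₘ (matrix p' q' r' s') (matrix p q r s) = multiplicative p q r s p' q' r' s'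
  where
  multiplicative : ∀ p q r s p' q' r' s' →
    (p * p' + r * q') * (q * r' + s * s') - (q * p' + s * q') * (p * r' + r * s') ≡ (p' * s' - q' * r') * (p * s - q * r)
  multiplicative = solve-∀

I : Matrix
I = matrix (+ 1) (+ 0) (+ 0) (+ 1)

inverse-rows : ∀ N M → N ∘ₘ M ≡ I → ∀ x y →
               row₁ N (row₁ M x y) (row₂ M x y) ≡ x × row₂ N (row₁ M x y) (row₂ M x y) ≡ y
inverse-rows N M N∘M≡I x y =
  trans (sym (proj₁ (∘ₘ-rows N M x y))) (trans (cong (λ L → row₁ L x y) N∘M≡I) (unit₁ x y)) ,
  trans (sym (proj₂ (∘ₘ-rows N M x y))) (trans (cong (λ L → row₂ L x y) N∘M≡I) (unit₂ x y))
  where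
  unit₁ : ∀ x y → x * + 1 + y * + 0 ≡ x
  unit₁ = solve-∀
  unit₂ : ∀ x y → x * + 0 + y * + 1 ≡ y
  unit₂ = solve-∀

fixes-basis⇒identity : ∀ D L → row₁ L (+ 1) (+ 0) ≡ + 1 → row₂ L (+ 1) (+ 0) ≡ + 0 →
                       row₁ L D (+ 1) ≡ D → row₂ L D (+ 1) ≡ + 1 → L ≡ I
fixes-basis⇒identity D (matrix p q r s) p≡ r≡ q≡ s≡ = entries p≡1 q≡0 r≡0 s≡1
  where
  entries : ∀ {p q r s p' q' r' s'} → p ≡ p' → q ≡ q' → r ≡ r' → s ≡ s' → matrix p q r s ≡ matrix p' q' r' s'
  entries refl refl refl refl = refl
  first : ∀ p q → p ≡ + 1 * p + + 0 * q
  first = solve-∀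
  second : ∀ D p q → q ≡ (D * p + + 1 * q) - D * p
  second = solve-∀
  p≡1 = trans (first p q) p≡
  r≡0 = trans (first r s) r≡
  q≡0 : q ≡ + 0
  q≡0 = trans (second D p q) (trans (cong₂ (λ a b → a - D * b) q≡ p≡1) (cancel D))
    where
    cancel : ∀ D → D - D * + 1 ≡ + 0
    cancel = solve-∀
  s≡1 : s ≡ + 1
  s≡1 = trans (second D r s) (trans (cong₂ (λ a b → a - D * b) s≡ r≡0) (cancel D))
    where
    cancel : ∀ D → + 1 - D * + 0 ≡ + 1
    cancel = solve-∀

Homomorphism : ∀ {D₁ D₂} → (OKPlus D₁ → OKPlus D₂) → Set
Homomorphism f = ∀ a b c → IsSum a b c → IsSum (f a) (f b) (f c)

-- A homomorphism is the restriction of the integral matrix recording the images of the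
-- basis 1, D + ω (both coordinates of f are additive, hence linear); in particular
-- this matrix maps the totally positive cone into the totally positive cone.
module HomomorphismMatrix {D₁ D₂} (1<D₁ : 1 ℕ.< D₁) (f : OKPlus D₁ → OKPlus D₂) (hom : Homomorphism f) where
  private
    D+ω = D+ω-of 1<D₁
    module X = AdditiveExtension 1<D₁ (λ o → x (f o)) (λ a b c sum → proj₁ (hom a b c sum))
    module Y = AdditiveExtension 1<D₁ (λ o → y (f o)) (λ a b c sum → proj₂ (hom a b c sum))

  matrixOf : Matrix
  matrixOf = matrix (x (f one)) (x (f D+ω) - + D₁ * x (f one)) (y (f one)) (y (f D+ω) - + D₁ * y (f one))

  represents : ∀ o → x (f o) ≡ row₁ matrixOf (x o) (y o) × y (f o) ≡ row₂ matrixOf (x o) (y o)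
  represents o = X.linear o , Y.linear o

  maps-cone : ∀ x y → Cone (halfω D₁) D₁ x y → Cone (halfω D₂) D₂ (row₁ matrixOf x y) (row₂ matrixOf x y)
  maps-cone x y cone = subst₂ (Cone (halfω D₂) D₂) (proj₁ (represents P)) (proj₂ (represents P)) (cone-of (f P))
    where
    P = element x y cone

-- If g ∘ f = id, the matrices of g and f are inverse: their composite fixes 1 and D + ω.
matrix-inverse : ∀ {D₁ D₂} (1<D₁ : 1 ℕ.< D₁) (1<D₂ : 1 ℕ.< D₂) (f : OKPlus D₁ → OKPlus D₂) (g : OKPlus D₂ → OKPlus D₁)
                 (hom-f : Homomorphism f) (hom-g : Homomorphism g) → (∀ a → g (f a) ≡ a) →
                 HomomorphismMatrix.matrixOf 1<D₂ g hom-g ∘ₘ HomomorphismMatrix.matrixOf 1<D₁ f hom-f ≡ I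
matrix-inverse {D₁} 1<D₁ 1<D₂ f g hom-f hom-g g∘f≡id =
  fixes-basis⇒identity (+ D₁) (G ∘ₘ F)
    (proj₁ (fixes one)) (proj₂ (fixes one)) (proj₁ (fixes (D+ω-of 1<D₁))) (proj₂ (fixes (D+ω-of 1<D₁)))
  where
  module F = HomomorphismMatrix 1<D₁ f hom-f
  module G = HomomorphismMatrix 1<D₂ g hom-g
  F = F.matrixOf
  G = G.matrixOf
  fixes : ∀ o → row₁ (G ∘ₘ F) (x o) (y o) ≡ x o × row₂ (G ∘ₘ F) (x o) (y o) ≡ y o
  fixes o =
    trans (proj₁ (∘ₘ-rows G F (x o) (y o))) (trans (sym (cong₂ (row₁ G) Fx Fy)) (trans (sym (proj₁ (G.represents (f o)))) (cong x (g∘f≡id o)))) ,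
    trans (proj₂ (∘ₘ-rows G F (x o) (y o))) (trans (sym (cong₂ (row₂ G) Fx Fy)) (trans (sym (proj₂ (G.represents (f o)))) (cong y (g∘f≡id o))))
    where
    Fx = proj₁ (F.represents o)
    Fy = proj₂ (F.represents o)

from-homomorphism : ∀ {D₁ D₂} (iso : SemigroupIso D₁ D₂) → Homomorphism (SemigroupIso.from iso)
from-homomorphism {D₁} iso a b c (c-x , c-y) = cong x from-c , cong y from-c
  where
  open SemigroupIso iso
  sum : OKPlus D₁
  sum = element (x (from a) + x (from b)) (y (from a) + y (from b)) (cone-+ (halfω D₁) D₁ (cone-of (from a)) (cone-of (from b)))
  to-sum : to sum ≡ c
  to-sum = OKPlus-≡
    (trans (proj₁ to-hom) (trans (cong₂ _+_ (cong x (to∘from a)) (cong x (to∘from b))) (sym c-x)))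
    (trans (proj₂ to-hom) (trans (cong₂ _+_ (cong y (to∘from a)) (cong y (to∘from b))) (sym c-y)))
    where
    to-hom = hom (from a) (from b) sum (refl , refl)
  from-c : from c ≡ sum
  from-c = trans (cong from (sym to-sum)) (from∘to sum)

record ConeIso (D₁ D₂ : ℕ) : Set where
  field
    M N : Matrix
    M-cone : ∀ x y → Cone (halfω D₁) D₁ x y → Cone (halfω D₂) D₂ (row₁ M x y) (row₂ M x y)
    N-cone : ∀ x y → Cone (halfω D₂) D₂ x y → Cone (halfω D₁) D₁ (row₁ N x y) (row₂ N x y)
    N∘M≡I : N ∘ₘ M ≡ I
    M∘N≡I : M ∘ₘ N ≡ I

ConeIso-sym : ∀ {D₁ D₂} → ConeIso D₁ D₂ → ConeIso D₂ D₁
ConeIso-sym φ = record { M = N ; N = M ; M-cone = N-cone ; N-cone = M-cone ; N∘M≡I = M∘N≡I ; M∘N≡I = N∘M≡I }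
  where open ConeIso φ

coneIso : ∀ {D₁ D₂} → 1 ℕ.< D₁ → 1 ℕ.< D₂ → SemigroupIso D₁ D₂ → ConeIso D₁ D₂
coneIso 1<D₁ 1<D₂ iso = record
  { M = To.matrixOf ; N = From.matrixOf ; M-cone = To.maps-cone ; N-cone = From.maps-cone
  ; N∘M≡I = matrix-inverse 1<D₁ 1<D₂ to from hom from-hom from∘to
  ; M∘N≡I = matrix-inverse 1<D₂ 1<D₁ from to from-hom hom to∘from
  }
  where
  open SemigroupIso iso
  from-hom = from-homomorphism iso
  module To = HomomorphismMatrix 1<D₁ to hom
  module From = HomomorphismMatrix 1<D₂ from from-hom

sign-change : (G : ℕ → ℤ) (m : ℕ) → G 0 < + 0 → + 0 ≤ G m →
              Σ ℕ λ k → k ℕ.< m × G k < + 0 × + 0 ≤ G (suc k)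
sign-change G zero G0<0 0≤Gm = ⊥-elim (<⇒≱ G0<0 0≤Gm)
sign-change G (suc m) G0<0 0≤Gm with G m <? + 0
... | yes Gm<0 = m , ℕP.≤-refl , Gm<0 , 0≤Gm
... | no Gm≮0 with sign-change G m G0<0 (≮⇒≥ Gm≮0)
...   | k , k<m , Gk<0 , 0≤Gk+1 = k , ℕP.m<n⇒m<1+n k<m , Gk<0 , 0≤Gk+1

quadratic-beats-linear : ∀ (k a b c P W R M : ℕ) → 1 ℕ.≤ k → k ℕ.* (suc M ℕ.* suc M) ℕ.≤ a ℕ.+ b ℕ.+ c →
  a ℕ.≤ P ℕ.* suc M → b ℕ.≤ W ℕ.* W → c ℕ.≤ R ℕ.* W ℕ.* suc M → M ≡ P ℕ.+ W ℕ.* W ℕ.+ R ℕ.* W → ⊥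
quadratic-beats-linear k a b c P W R M 1≤k kN²≤ a≤ b≤ c≤ refl = ℕP.<⇒≱ MN<NN NN≤MN
  where
  open ℕP.≤-Reasoning
  N = suc M
  collect : ∀ P W R N → P ℕ.* N ℕ.+ W ℕ.* W ℕ.* N ℕ.+ R ℕ.* W ℕ.* N ≡ (P ℕ.+ W ℕ.* W ℕ.+ R ℕ.* W) ℕ.* N
  collect = NatSolver.solve-∀
  NN≤MN : N ℕ.* N ℕ.≤ M ℕ.* N
  NN≤MN = begin
    N ℕ.* N                                          ≡⟨ sym (ℕP.*-identityˡ (N ℕ.* N)) ⟩
    1 ℕ.* (N ℕ.* N)                                  ≤⟨ ℕP.*-monoˡ-≤ (N ℕ.* N) 1≤k ⟩
    k ℕ.* (N ℕ.* N)                                  ≤⟨ kN²≤ ⟩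
    a ℕ.+ b ℕ.+ c                                    ≤⟨ ℕP.+-mono-≤ (ℕP.+-mono-≤ a≤ (ℕP.≤-trans b≤ (ℕP.m≤m*n (W ℕ.* W) N))) c≤ ⟩
    P ℕ.* N ℕ.+ W ℕ.* W ℕ.* N ℕ.+ R ℕ.* W ℕ.* N          ≡⟨ collect P W R N ⟩
    M ℕ.* N                                          ∎
  MN<NN : M ℕ.* N ℕ.< N ℕ.* N
  MN<NN = ℕP.m<n+m (M ℕ.* N) {N} (s≤s z≤n)

-- Rigidity of an indefinite anisotropic form Q = x² + bxy + cy² with b ≥ 0, c < 0 and
-- Q(K y, y) = E y², E > 0.  An integral form F = f x² + g xy + h y² with F > 0 where
-- Q > 0 and F ≤ 0 where Q < 0 is a multiple of Q: g = f b and h = f c.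
-- (F must vanish on the irrational boundary rays of {Q > 0}.)  Discretely: F = f·Q + y·w
-- with w = u x + v y; at a sign change of Q between (x, N) and (x + 1, N), both Q and w
-- are O(N), whereas Q(−v, u)·N² = u² Q(x, N) − w² − r w N; as Q(−v, u) ≠ 0 unless
-- u = v = 0, choosing N large gives a contradiction.
module Proportionality
  (b : ℕ) (c E : ℤ) (K : ℕ) (c<0 : c < + 0) (0<E : + 0 < E)
  (on-ray : ∀ y → form (+ 1) (+ b) c (+ K * y) y ≡ E * (y * y))
  (anisotropic : ∀ x y → form (+ 1) (+ b) c x y ≡ + 0 → x ≡ + 0 × y ≡ + 0)
  (f g h : ℤ)
  (positive : ∀ x y → + 0 < form (+ 1) (+ b) c x y → + 0 < form f g h x y)
  (nonpositive : ∀ x y → form (+ 1) (+ b) c x y < + 0 → form f g h x y ≤ + 0) where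

  Q : ℤ → ℤ → ℤ
  Q = form (+ 1) (+ b) c

  u v r : ℤ
  u = g - f * + b
  v = h - f * c
  r = + b * u - + 2 * v

  0<f : + 0 < f
  0<f = subst (+ 0 <_) (value-at-1,0 f g h) (positive (+ 1) (+ 0) (subst (+ 0 <_) (sym (value-at-1,0 (+ 1) (+ b) c)) (+<+ (s≤s z≤n))))
    where
    value-at-1,0 : ∀ f g h → f * + 1 * + 1 + g * + 1 * + 0 + h * + 0 * + 0 ≡ f
    value-at-1,0 = solve-∀

  F-split : ∀ x y → form f g h x y ≡ f * Q x y + y * (u * x + v * y)
  F-split = split f g h (+ b) c
    where
    split : ∀ f g h b c x y → f * x * x + g * x * y + h * y * y ≡
            f * (+ 1 * x * x + b * x * y + c * y * y) + y * ((g - f * b) * x + (h - f * c) * y)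
    split = solve-∀

  -- The bound C N on |Q| at a sign change on the line y = N, and the bound W on |w|.
  Cz : ℤ
  Cz = + 2 * + K + + 1 + + b
  0≤Cz : + 0 ≤ Cz
  0≤Cz = +-mono-≤ (+-mono-≤ (0≤* (0≤ℕ 2) (0≤ℕ K)) (0≤ℕ 1)) (0≤ℕ b)
  C : ℕ
  C = ∣ Cz ∣
  Wz : ℤ
  Wz = f * Cz + + ∣ u ∣
  W : ℕ
  W = ∣ Wz ∣

  -- Q changes sign on each line y = N > 0: Q(0, N) = c N² < 0 ≤ E N² = Q(K N, N).
  sign-change-at-height : ∀ N → Σ ℕ λ x₀ → x₀ ℕ.< K ℕ.* suc N × Q (+ x₀) (+ suc N) < + 0 × + 0 ≤ Q (+ suc x₀) (+ suc N)
  sign-change-at-height N = sign-change (λ k → Q (+ k) (+ suc N)) (K ℕ.* suc N) Q0<0 0≤QKN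
    where
    0<N² : + 0 < + suc N * + suc N
    0<N² = +<+ (s≤s z≤n)
    at-x=0 : ∀ b c y → + 1 * + 0 * + 0 + b * + 0 * y + c * y * y ≡ c * (y * y)
    at-x=0 = solve-∀
    Q0<0 : Q (+ 0) (+ suc N) < + 0
    Q0<0 = subst (_< + 0) (sym (at-x=0 (+ b) c (+ suc N))) (*-neg-pos c<0 0<N²)
    0≤QKN : + 0 ≤ Q (+ (K ℕ.* suc N)) (+ suc N)
    0≤QKN = subst (λ t → + 0 ≤ Q t (+ suc N)) (sym (pos-* K (suc N)))
              (subst (+ 0 ≤_) (sym (on-ray (+ suc N))) (<⇒≤ (0<* 0<E 0<N²)))

  module AtSignChange (n x₀ : ℕ) (x₀<KN : x₀ ℕ.< K ℕ.* suc n)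
         (below : Q (+ x₀) (+ suc n) < + 0) (above : + 0 ≤ Q (+ suc x₀) (+ suc n)) where
    N : ℕ
    N = suc n
    Nz X : ℤ
    Nz = + N
    X = + x₀
    q₀ q₁ w : ℤ
    q₀ = Q X Nz
    q₁ = Q (X + + 1) Nz
    w = u * X + v * Nz

    suc≡+1 : + suc x₀ ≡ X + + 1
    suc≡+1 = cong +_ (ℕP.+-comm 1 x₀)

    0<q₁ : + 0 < q₁
    0<q₁ = ≤∧≢⇒< (subst (λ t → + 0 ≤ Q t Nz) suc≡+1 above) (λ q₁≡0 → N≢0 (proj₂ (anisotropic (X + + 1) Nz (sym q₁≡0))))
      where
      N≢0 : Nz ≢ + 0
      N≢0 ()

    x+1≤KN : X + + 1 ≤ + K * Nz
    x+1≤KN = subst₂ _≤_ suc≡+1 (pos-* K N) (+≤+ x₀<KN)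

    -- Q(x₀ + 1, N) − Q(x₀, N) = 2 x₀ + 1 + b N ≤ C N bounds both values.
    -q₀≤CN : - q₀ ≤ Cz * Nz
    -q₀≤CN = ≤-by _ (+-mono-≤ (+-mono-≤ (+-mono-≤ (0≤* (0≤ℕ 2) (i≤j⇒0≤j-i x+1≤KN)) (0≤ℕ N)) (<⇒≤ 0<q₁)) (0≤ℕ 1))
                   (difference (+ b) c X Nz (+ K))
      where
      difference : ∀ b c x y K → (+ 2 * K + + 1 + b) * y - (- (+ 1 * x * x + b * x * y + c * y * y)) ≡
        + 2 * (K * y - (x + + 1)) + y + (+ 1 * (x + + 1) * (x + + 1) + b * (x + + 1) * y + c * y * y) + + 1
      difference = solve-∀

    q₁≤CN : q₁ ≤ Cz * Nz
    q₁≤CN = ≤-by _ (+-mono-≤ (+-mono-≤ (+-mono-≤ (0≤* (0≤ℕ 2) (i≤j⇒0≤j-i x+1≤KN)) (0≤ℕ N)) (0≤ℕ 1)) (i≤j⇒0≤j-i (<⇒≤ below)))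
                  (difference (+ b) c X Nz (+ K))
      where
      difference : ∀ b c x y K → (+ 2 * K + + 1 + b) * y - (+ 1 * (x + + 1) * (x + + 1) + b * (x + + 1) * y + c * y * y) ≡
        + 2 * (K * y - (x + + 1)) + y + + 1 + (+ 0 - (+ 1 * x * x + b * x * y + c * y * y))
      difference = solve-∀

    ∣q₀∣≤CN : ∣ q₀ ∣ ℕ.≤ C ℕ.* N
    ∣q₀∣≤CN = ∣∣-≤ q₀ (C ℕ.* N)
      (subst₂ _≤_ (cong -_ (sym CN≡)) (neg-involutive q₀) (neg-mono-≤ -q₀≤CN))
      (subst (q₀ ≤_) (sym CN≡) (≤-trans (<⇒≤ below) (0≤* 0≤Cz (0≤ℕ N))))
      where
      CN≡ : + (C ℕ.* N) ≡ Cz * Nz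
      CN≡ = trans (pos-* C N) (cong (_* Nz) (0≤i⇒+∣i∣≡i 0≤Cz))

    -- F(x₀, N) = f q₀ + N w ≤ 0 and F(x₀ + 1, N) = f q₁ + N (w + u) > 0 squeeze w.
    w≤fC : w ≤ f * Cz
    w≤fC = *-cancelˡ-≤-pos w (f * Cz) Nz
      (≤-by _ (+-mono-≤ (0≤* (<⇒≤ 0<f) (i≤j⇒0≤j-i -q₀≤CN)) (i≤j⇒0≤j-i F≤0)) (rearrange Nz f Cz q₀ w))
      where
      F≤0 : f * q₀ + Nz * w ≤ + 0
      F≤0 = subst (_≤ + 0) (F-split X Nz) (nonpositive X Nz below)
      rearrange : ∀ N f C q₀ w → N * (f * C) - N * w ≡ f * (C * N - (- q₀)) + (+ 0 - (f * q₀ + N * w))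
      rearrange = solve-∀

    -fC-u<w : - (f * Cz) - u < w
    -fC-u<w = *-cancelˡ-<-nonNeg Nz
      (<-by _ (+-mono-<-≤ (0<-diff 0<F) (0≤* (<⇒≤ 0<f) (i≤j⇒0≤j-i q₁≤CN))) (rearrange Nz f Cz q₁ u v X))
      where
      0<F : + 0 < f * q₁ + Nz * (u * (X + + 1) + v * Nz)
      0<F = subst (+ 0 <_) (F-split (X + + 1) Nz) (positive (X + + 1) Nz 0<q₁)
      rearrange : ∀ N f C q₁ u v x → N * (u * x + v * N) - N * (- (f * C) - u) ≡
                  (f * q₁ + N * (u * (x + + 1) + v * N) - + 0) + f * (C * N - q₁)
      rearrange = solve-∀

    ∣w∣≤W : ∣ w ∣ ℕ.≤ W
    ∣w∣≤W = ∣∣-≤ w W (subst (λ t → - t ≤ w) (sym W≡) -W≤w) (subst (w ≤_) (sym W≡) (≤-trans w≤fC (i≤i+j (f * Cz) (+ ∣ u ∣))))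
      where
      W≡ : + W ≡ Wz
      W≡ = 0≤i⇒+∣i∣≡i (+-mono-≤ (0≤* (<⇒≤ 0<f) 0≤Cz) (0≤ℕ ∣ u ∣))
      rearrange : ∀ fC u ∣u∣ → - fC - u - (- (fC + ∣u∣)) ≡ ∣u∣ - u
      rearrange = solve-∀
      -W≤w : - Wz ≤ w
      -W≤w = ≤-trans (≤-by _ (i≤j⇒0≤j-i (i≤∣i∣ u)) (rearrange (f * Cz) u (+ ∣ u ∣))) (<⇒≤ -fC-u<w)

    residue : Q (- v) u * (Nz * Nz) ≡ u * u * q₀ + - (w * w) + - (r * w * Nz)
    residue = identity (+ b) c u v X Nz
      where
      identity : ∀ b c u v x y →
        (+ 1 * (- v) * (- v) + b * (- v) * u + c * u * u) * (y * y) ≡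
        u * u * (+ 1 * x * x + b * x * y + c * y * y) + (- ((u * x + v * y) * (u * x + v * y)))
          + (- ((b * u - + 2 * v) * (u * x + v * y) * y))
      identity = solve-∀

    residue-terms : ℕ
    residue-terms = ∣ u * u * q₀ ∣ ℕ.+ ∣ - (w * w) ∣ ℕ.+ ∣ - (r * w * Nz) ∣

    residue-bound : ∣ Q (- v) u ∣ ℕ.* (N ℕ.* N) ℕ.≤ residue-terms
    residue-bound = begin
      ∣ Q (- v) u ∣ ℕ.* ∣ Nz * Nz ∣         ≡⟨ sym (∣i*j∣≡∣i∣*∣j∣ (Q (- v) u) (Nz * Nz)) ⟩
      ∣ Q (- v) u * (Nz * Nz) ∣            ≡⟨ cong ∣_∣ residue ⟩
      ∣ u * u * q₀ + - (w * w) + - (r * w * Nz) ∣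
                                          ≤⟨ ℕP.≤-trans (∣i+j∣≤∣i∣+∣j∣ (u * u * q₀ + - (w * w)) _) (ℕP.+-monoˡ-≤ _ (∣i+j∣≤∣i∣+∣j∣ (u * u * q₀) _)) ⟩
      ∣ u * u * q₀ ∣ ℕ.+ ∣ - (w * w) ∣ ℕ.+ ∣ - (r * w * Nz) ∣ ∎
      where open ℕP.≤-Reasoning

    u²q₀-bound : ∣ u * u * q₀ ∣ ℕ.≤ ∣ u ∣ ℕ.* ∣ u ∣ ℕ.* C ℕ.* N
    u²q₀-bound = subst₂ ℕ._≤_ (sym (trans (∣i*j∣≡∣i∣*∣j∣ (u * u) q₀) (cong (ℕ._* ∣ q₀ ∣) (∣i*j∣≡∣i∣*∣j∣ u u))))
                   (sym (ℕP.*-assoc (∣ u ∣ ℕ.* ∣ u ∣) C N)) (ℕP.*-monoʳ-≤ (∣ u ∣ ℕ.* ∣ u ∣) ∣q₀∣≤CN)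

    w²-bound : ∣ - (w * w) ∣ ℕ.≤ W ℕ.* W
    w²-bound = subst (ℕ._≤ W ℕ.* W) (sym (trans (∣-i∣≡∣i∣ (w * w)) (∣i*j∣≡∣i∣*∣j∣ w w))) (ℕP.*-mono-≤ ∣w∣≤W ∣w∣≤W)

    rwN-bound : ∣ - (r * w * Nz) ∣ ℕ.≤ ∣ r ∣ ℕ.* W ℕ.* N
    rwN-bound = subst (ℕ._≤ ∣ r ∣ ℕ.* W ℕ.* N)
      (sym (trans (∣-i∣≡∣i∣ (r * w * Nz)) (trans (∣i*j∣≡∣i∣*∣j∣ (r * w) Nz) (cong (ℕ._* N) (∣i*j∣≡∣i∣*∣j∣ r w)))))
      (ℕP.*-monoˡ-≤ N (ℕP.*-monoʳ-≤ ∣ r ∣ ∣w∣≤W))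

  -- Taking N = M + 1 with M = u² C + W² + |r| W forces Q(−v, u) = 0.
  residue-vanishes : Q (- v) u ≡ + 0
  residue-vanishes with ∣ Q (- v) u ∣ in eq
  ... | zero = ∣i∣≡0⇒i≡0 eq
  ... | suc k = ⊥-elim (quadratic-beats-linear (suc k) (∣ u * u * S.q₀ ∣) (∣ - (S.w * S.w) ∣) (∣ - (r * S.w * S.Nz) ∣)
                  P W ∣ r ∣ M (s≤s z≤n) (subst (λ t → t ℕ.* (suc M ℕ.* suc M) ℕ.≤ S.residue-terms) eq S.residue-bound) S.u²q₀-bound S.w²-bound S.rwN-bound refl)
    where
    P M : ℕ
    P = ∣ u ∣ ℕ.* ∣ u ∣ ℕ.* C
    M = P ℕ.+ W ℕ.* W ℕ.+ ∣ r ∣ ℕ.* W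
    change = sign-change-at-height M
    module S = AtSignChange M (proj₁ change) (proj₁ (proj₂ change)) (proj₁ (proj₂ (proj₂ change))) (proj₂ (proj₂ (proj₂ change)))

  proportional : g ≡ f * + b × h ≡ f * c
  proportional = i-j≡0⇒i≡j g (f * + b) u≡0 , i-j≡0⇒i≡j h (f * c) (trans (sym (neg-involutive v)) (cong -_ -v≡0))
    where
    -v≡0 = proj₁ (anisotropic (- v) u residue-vanishes)
    u≡0 = proj₂ (anisotropic (- v) u residue-vanishes)

form-neg : ∀ a b c x y → form a b c (- x) (- y) ≡ form a b c x y
form-neg = even
  where
  even : ∀ a b c x y → a * (- x) * (- x) + b * (- x) * (- y) + c * (- y) * (- y) ≡ a * x * x + b * x * y + c * y * y
  even = solve-∀

row₁-neg : ∀ M x y → row₁ M (- x) (- y) ≡ - row₁ M x y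
row₁-neg (matrix p q _ _) = linear p q
  where
  linear : ∀ p q x y → (- x) * p + (- y) * q ≡ - (x * p + y * q)
  linear = solve-∀

row₂-neg : ∀ M x y → row₂ M (- x) (- y) ≡ - row₂ M x y
row₂-neg (matrix _ _ r s) = linear r s
  where
  linear : ∀ r s x y → (- x) * r + (- y) * s ≡ - (x * r + y * s)
  linear = solve-∀

mixed : ℤ → ℤ → ℤ → Matrix → ℤ
mixed a b c (matrix p q r s) = + 2 * a * p * q + b * (p * s + q * r) + + 2 * c * r * s

pullback : ∀ a b c p q r s x y → form a b c (row₁ (matrix p q r s) x y) (row₂ (matrix p q r s) x y) ≡
           form (form a b c p r) (mixed a b c (matrix p q r s)) (form a b c q s) x y
pullback = identity
  where
  identity : ∀ a b c p q r s x y →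
    a * (x * p + y * q) * (x * p + y * q) + b * (x * p + y * q) * (x * r + y * s) + c * (x * r + y * s) * (x * r + y * s) ≡
    (a * p * p + b * p * r + c * r * r) * x * x + (+ 2 * a * p * q + b * (p * s + q * r) + + 2 * c * r * s) * x * y
      + (a * q * q + b * q * s + c * s * s) * y * y
  identity = solve-∀

discriminant-pullback : ∀ a b c p q r s →
  discriminant (form a b c p r) (mixed a b c (matrix p q r s)) (form a b c q s) ≡ det (matrix p q r s) * det (matrix p q r s) * discriminant a b c
discriminant-pullback = identity
  where
  identity : ∀ a b c p q r s →
    (+ 2 * a * p * q + b * (p * s + q * r) + + 2 * c * r * s) * (+ 2 * a * p * q + b * (p * s + q * r) + + 2 * c * r * s)
      - + 4 * (a * p * p + b * p * r + c * r * r) * (a * q * q + b * q * s + c * s * s) ≡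
    (p * s - q * r) * (p * s - q * r) * (b * b - + 4 * a * c)
  identity = solve-∀

-- For a linear cone isomorphism (M, N) from K₁ to K₂, the norm form Q₂ of K₂ pulls back
-- along M to a positive multiple f·Q₁ of the norm form of K₁: F = Q₂ ∘ M is positive
-- where Q₁ > 0 (M maps ± the cone of K₁ into ± that of K₂) and nonpositive where Q₁ < 0
-- (otherwise N would carry ±(x, y) into the cone of K₁), so Proportionality applies.
module NormPullback {D₁ D₂} (iso : ConeIso D₁ D₂) (NF₁ : NormForm (halfω D₁) D₁) (NF₂ : NormForm (halfω D₂) D₂)
  (squarefree₁ : SquareFree D₁) (1<D₁ : 1 ℕ.< D₁) where
  open ConeIso iso
  private
    module NF₁ = NormForm NF₁
    module NF₂ = NormForm NF₂
    module Facts₁ = NormFormFacts NF₁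
    module Facts₂ = NormFormFacts NF₂
    Q₁ = Facts₁.Q
    Q₂ = Facts₂.Q

  f g h : ℤ
  f = Q₂ (Matrix.p M) (Matrix.r M)
  g = mixed (+ 1) (+ NF₂.b) NF₂.c M
  h = Q₂ (Matrix.q M) (Matrix.s M)

  Q₂∘M : ∀ x y → Q₂ (row₁ M x y) (row₂ M x y) ≡ form f g h x y
  Q₂∘M = pullback (+ 1) (+ NF₂.b) NF₂.c (Matrix.p M) (Matrix.q M) (Matrix.r M) (Matrix.s M)

  F-positive : ∀ x y → + 0 < Q₁ x y → + 0 < form f g h x y
  F-positive x y 0<Q₁ = subst (+ 0 <_) (Q₂∘M x y) (on-±cone (Facts₁.Q>0⇒±cone 0<Q₁))
    where
    on-±cone : Cone (halfω D₁) D₁ x y ⊎ Cone (halfω D₁) D₁ (- x) (- y) → + 0 < Q₂ (row₁ M x y) (row₂ M x y)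
    on-±cone (inj₁ cone) = Facts₂.cone⇒Q>0 (M-cone x y cone)
    on-±cone (inj₂ cone) = subst (+ 0 <_) (trans (cong₂ Q₂ (row₁-neg M x y) (row₂-neg M x y)) (form-neg (+ 1) (+ NF₂.b) NF₂.c (row₁ M x y) (row₂ M x y)))
                             (Facts₂.cone⇒Q>0 (M-cone (- x) (- y) cone))

  F-nonpositive : ∀ x y → Q₁ x y < + 0 → form f g h x y ≤ + 0
  F-nonpositive x y Q₁<0 = ≮⇒≥ λ 0<F → <-asym Q₁<0 (back (Facts₂.Q>0⇒±cone (subst (+ 0 <_) (sym (Q₂∘M x y)) 0<F)))
    where
    Mx = row₁ M x y
    My = row₂ M x y
    N∘M = inverse-rows N M N∘M≡I x y
    back : Cone (halfω D₂) D₂ (row₁ M x y) (row₂ M x y) ⊎ Cone (halfω D₂) D₂ (- row₁ M x y) (- row₂ M x y) → + 0 < Q₁ x y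
    back (inj₁ cone) = Facts₁.cone⇒Q>0 (subst₂ (Cone (halfω D₁) D₁) (proj₁ N∘M) (proj₂ N∘M) (N-cone Mx My cone))
    back (inj₂ cone) = subst (+ 0 <_) (form-neg (+ 1) (+ NF₁.b) NF₁.c x y) (Facts₁.cone⇒Q>0 (subst₂ (Cone (halfω D₁) D₁)
                         (trans (row₁-neg N Mx My) (cong -_ (proj₁ N∘M))) (trans (row₂-neg N Mx My) (cong -_ (proj₂ N∘M)))
                         (N-cone (- Mx) (- My) cone)))

  open Proportionality NF₁.b NF₁.c NF₁.E D₁ NF₁.c<0 NF₁.0<E NF₁.on-ray (Facts₁.anisotropic squarefree₁ 1<D₁)
                       f g h F-positive F-nonpositive public using (0<f; proportional)

  scaled : ∀ x y → Q₂ (row₁ M x y) (row₂ M x y) ≡ f * Q₁ x y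
  scaled x y = trans (Q₂∘M x y) (trans (cong₂ (λ g' h' → form f g' h' x y) (proj₁ proportional) (proj₂ proportional))
                                        (factor f (+ NF₁.b) NF₁.c x y))
    where
    factor : ∀ f b c x y → f * x * x + f * b * x * y + f * c * y * y ≡ f * (+ 1 * x * x + b * x * y + c * y * y)
    factor = solve-∀

  scaled-discriminant : f * f * discriminant (+ 1) (+ NF₁.b) NF₁.c ≡ det M * det M * discriminant (+ 1) (+ NF₂.b) NF₂.c
  scaled-discriminant = begin
    f * f * discriminant (+ 1) (+ NF₁.b) NF₁.c              ≡⟨ factor f (+ NF₁.b) NF₁.c ⟩
    discriminant f (f * + NF₁.b) (f * NF₁.c)                ≡⟨ cong₂ (discriminant f) (sym (proj₁ proportional)) (sym (proj₂ proportional)) ⟩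
    discriminant f g h                                      ≡⟨ discriminant-pullback (+ 1) (+ NF₂.b) NF₂.c (Matrix.p M) (Matrix.q M) (Matrix.r M) (Matrix.s M) ⟩
    det M * det M * discriminant (+ 1) (+ NF₂.b) NF₂.c      ∎
    where
    open ≡-Reasoning
    factor : ∀ f b c → f * f * (b * b - + 4 * + 1 * c) ≡ (f * b) * (f * b) - + 4 * f * (f * c)
    factor = solve-∀

divisor-of-one : ∀ i j → i * j ≡ + 1 → ∣ j ∣ ≡ 1
divisor-of-one i j ij≡1 = ℕP.m*n≡1⇒n≡1 ∣ i ∣ ∣ j ∣ (trans (sym (∣i*j∣≡∣i∣*∣j∣ i j)) (cong ∣_∣ ij≡1))

unit-square : ∀ i j → i * j ≡ + 1 → j * j ≡ + 1
unit-square i j ij≡1 = square j (divisor-of-one i j ij≡1)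
  where
  square : ∀ j → ∣ j ∣ ≡ 1 → j * j ≡ + 1
  square (+ 1) _ = refl
  square -[1+ 0 ] _ = refl

unit-positive : ∀ i j → i * j ≡ + 1 → + 0 < j → j ≡ + 1
unit-positive i (+ n) ij≡1 _ = cong +_ (divisor-of-one i (+ n) ij≡1)

-- Linearly isomorphic totally positive cones force equal field discriminants: the two
-- scaling factors of the norm forms multiply to 1 and are positive, so both are 1, and
-- det M = ±1 because det N · det M = det I.
coneIso⇒equal-discriminants : ∀ {D₁ D₂} → IsRealQuadParam D₁ → IsRealQuadParam D₂ → ConeIso D₁ D₂ →
                              fieldDisc (halfω D₁) D₁ ≡ fieldDisc (halfω D₂) D₂
coneIso⇒equal-discriminants {D₁} {D₂} (1<D₁ , squarefree₁) (1<D₂ , squarefree₂) iso = begin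
  fieldDisc (halfω D₁) D₁          ≡⟨ sym NF₁.disc ⟩
  disc₁                            ≡⟨ sym (*-identityˡ disc₁) ⟩
  + 1 * + 1 * disc₁                ≡⟨ cong (λ t → t * t * disc₁) (sym f≡1) ⟩
  Fw.f * Fw.f * disc₁              ≡⟨ Fw.scaled-discriminant ⟩
  det M * det M * disc₂            ≡⟨ cong (_* disc₂) (unit-square (det N) (det M) detN*detM≡1) ⟩
  + 1 * disc₂                      ≡⟨ *-identityˡ disc₂ ⟩
  disc₂                            ≡⟨ NF₂.disc ⟩
  fieldDisc (halfω D₂) D₂          ∎
  where
  open ≡-Reasoning
  open ConeIso iso
  NF₁ = normForm D₁ 1<D₁
  NF₂ = normForm D₂ 1<D₂
  module NF₁ = NormForm NF₁
  module NF₂ = NormForm NF₂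
  module Fw = NormPullback iso NF₁ NF₂ squarefree₁ 1<D₁
  module Bw = NormPullback (ConeIso-sym iso) NF₂ NF₁ squarefree₂ 1<D₂
  disc₁ = discriminant (+ 1) (+ NF₁.b) NF₁.c
  disc₂ = discriminant (+ 1) (+ NF₂.b) NF₂.c
  Q₁ = NormFormFacts.Q NF₁
  Q₁[1,0]≡1 : ∀ b c → + 1 * + 1 * + 1 + b * + 1 * + 0 + c * + 0 * + 0 ≡ + 1
  Q₁[1,0]≡1 = solve-∀
  round-trip : Q₁ (+ 1) (+ 0) ≡ Bw.f * (Fw.f * Q₁ (+ 1) (+ 0))
  round-trip = begin
    Q₁ (+ 1) (+ 0)                                                 ≡⟨ sym (cong₂ Q₁ (proj₁ N∘M) (proj₂ N∘M)) ⟩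
    Q₁ (row₁ N (row₁ M (+ 1) (+ 0)) (row₂ M (+ 1) (+ 0))) (row₂ N (row₁ M (+ 1) (+ 0)) (row₂ M (+ 1) (+ 0)))
                                                                   ≡⟨ Bw.scaled (row₁ M (+ 1) (+ 0)) (row₂ M (+ 1) (+ 0)) ⟩
    Bw.f * NormFormFacts.Q NF₂ (row₁ M (+ 1) (+ 0)) (row₂ M (+ 1) (+ 0)) ≡⟨ cong (Bw.f *_) (Fw.scaled (+ 1) (+ 0)) ⟩
    Bw.f * (Fw.f * Q₁ (+ 1) (+ 0))                                 ∎
    where
    N∘M = inverse-rows N M N∘M≡I (+ 1) (+ 0)
  f≡1 : Fw.f ≡ + 1
  f≡1 = unit-positive Bw.f Fw.f product≡1 Fw.0<f
    where
    product≡1 : Bw.f * Fw.f ≡ + 1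
    product≡1 = begin
      Bw.f * Fw.f                      ≡⟨ cong (Bw.f *_) (sym (*-identityʳ Fw.f)) ⟩
      Bw.f * (Fw.f * + 1)              ≡⟨ cong (λ t → Bw.f * (Fw.f * t)) (sym (Q₁[1,0]≡1 (+ NF₁.b) NF₁.c)) ⟩
      Bw.f * (Fw.f * Q₁ (+ 1) (+ 0))   ≡⟨ sym round-trip ⟩
      Q₁ (+ 1) (+ 0)                   ≡⟨ Q₁[1,0]≡1 (+ NF₁.b) NF₁.c ⟩
      + 1                              ∎
  detN*detM≡1 : det N * det M ≡ + 1
  detN*detM≡1 = trans (sym (det-∘ₘ N M)) (cong det N∘M≡I)

not-multiple-of-4 : ∀ D D' → halfω D ≡ true → + D ≡ + 4 * + D' → ⊥
not-multiple-of-4 D D' D≡1 D≡4D' with subst (λ t → (t ≡ᵇ 1) ≡ true) D%4≡0 D≡1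
  where
  D≡D'*4 : D ≡ D' ℕ.* 4
  D≡D'*4 = +-injective (trans D≡4D' (trans (sym (pos-* 4 D')) (cong +_ (ℕP.*-comm 4 D'))))
  D%4≡0 : D % 4 ≡ 0
  D%4≡0 = trans (cong (_% 4) D≡D'*4) (m*n%n≡0 D' 4)
... | ()

fieldDisc-injective : ∀ D₁ D₂ → fieldDisc (halfω D₁) D₁ ≡ fieldDisc (halfω D₂) D₂ → D₁ ≡ D₂
fieldDisc-injective D₁ D₂ with halfω D₁ in h₁ | halfω D₂ in h₂
... | true  | true  = +-injective
... | false | false = λ e → +-injective (*-cancelˡ-≡ (+ 4) (+ D₁) (+ D₂) e)
... | true  | false = λ e → ⊥-elim (not-multiple-of-4 D₁ D₂ h₁ e)
... | false | true  = λ e → ⊥-elim (not-multiple-of-4 D₂ D₁ h₂ (sym e))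

theorem4p3 : (D₁ D₂ : ℕ) → IsRealQuadParam D₁ → IsRealQuadParam D₂ →
    D₁ ≢ D₂ → ¬ SemigroupIso D₁ D₂
theorem4p3 D₁ D₂ K₁@(1<D₁ , _) K₂@(1<D₂ , _) D₁≢D₂ iso =
  D₁≢D₂ (fieldDisc-injective D₁ D₂ (coneIso⇒equal-discriminants K₁ K₂ (coneIso 1<D₁ 1<D₂ iso)))
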